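{- Let $G=(V,E)$ be a prime permutation graph, let $(<_1,<_2)$ be a realizer of $G$, and let $w$ be the first element of $<_1$. Then $\vartriangleleft_1^w={<_1}$ and $\vartriangleleft_2^w={<_2}$.
   Context: A realizer of $G$ is a pair $(<_1,<_2)$ of strict linear orders on $V$ such that distinct $u,v$ are adjacent iff they occur in different order in $<_1$ and $<_2$; permutation graphs are graphs having a realizer. $G$ is prime if its only modules are $V$ and singletons, where a module is a non-empty $M\subseteq V$ with $\{u,x\}\in E\iff\{u,x'\}\in E$ for all $u\notin M$, $x,x'\in M$. For binary relations $\vartriangleleft_1,\vartriangleleft_2$ on $V$, their closure under $E$ is $(\vartriangleleft_1^E,\vartriangleleft_2^E)$ with $\vartriangleleft_i^E=\vartriangleleft_i\cup\{(v,u)\mid u\vartriangleleft_{3-i}v,\ \{u,v\}\in E\}\cup\{(u,v)\mid u\vartriangleleft_{3-i}v,\ \{u,v\}\notin E\}$; $(\cdot,\cdot)^T$ takes the transitive closure of each component. Define $\vartriangleleft_{1,0}^w=\{(w,v)\mid v\in V,v\neq w\}$, $\vartriangleleft_{2,0}^w=\emptyset$, and $(\vartriangleleft_{1,k+1}^w,\vartriangleleft_{2,k+1}^w)=((\vartriangleleft_{1,k}^w,\vartriangleleft_{2,k}^w)^E)^T$ for $k\ge0$. These increase with $k$; $\vartriangleleft_i^w$ denotes $\vartriangleleft_{i,m}^w$ for $m$ such that the sequence has stabilized. -}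

module Defs where

open import Level using (0ℓ)
open import Data.Nat using (ℕ; zero; suc; _≥_)
open import Data.Fin using (Fin)
open import Data.Fin.Subset using (Subset; _∈_; _∉_; Nonempty; ⊤; ⁅_⁆)
open import Data.Product using (_×_; _,_; ∃; proj₁; proj₂)
open import Data.Sum using (_⊎_)
open import Relation.Nullary using (¬_)
open import Relation.Binary.Core using (Rel)
open import Relation.Binary.Structures using (IsStrictTotalOrder)
open import Relation.Binary.PropositionalEquality using (_≡_)
open import Relation.Binary.Construct.Closure.Transitive using (TransClosure)
open import Function.Bundles using (_⇔_)

record SimpleGraph (n : ℕ) : Set₁ where
  field
    E       : Rel (Fin n) 0ℓ
    sym     : ∀ {u v} → E u v → E v u
    irrefl  : ∀ {u} → ¬ E u u
open SimpleGraph public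

IsModule : ∀ {n} → SimpleGraph n → Subset n → Set
IsModule G M = Nonempty M ×
  (∀ u x x′ → u ∉ M → x ∈ M → x′ ∈ M → (E G u x ⇔ E G u x′))

Prime : ∀ {n} → SimpleGraph n → Set
Prime {n} G = ∀ (M : Subset n) → IsModule G M → (M ≡ ⊤ ⊎ ∃ λ x → M ≡ ⁅ x ⁆)

record Realizer {n} (G : SimpleGraph n) : Set₁ where
  field
    _<₁_ : Rel (Fin n) 0ℓ
    _<₂_ : Rel (Fin n) 0ℓ
    lin₁ : IsStrictTotalOrder _≡_ _<₁_
    lin₂ : IsStrictTotalOrder _≡_ _<₂_
    adj  : ∀ u v → ¬ u ≡ v →
           (E G u v ⇔ ((u <₁ v × v <₂ u) ⊎ (v <₁ u × u <₂ v)))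
open Realizer public

-- Closure under E of (◁₁, ◁₂), first component (second one: swap arguments):
-- ◁ᵢ ∪ {(v,u) | u ◁_{3-i} v, uv ∈ E} ∪ {(u,v) | u ◁_{3-i} v, uv ∉ E}.
closeE : ∀ {n} → SimpleGraph n → Rel (Fin n) 0ℓ → Rel (Fin n) 0ℓ → Rel (Fin n) 0ℓ
closeE G R S a b = R a b ⊎ (S b a × E G a b) ⊎ (S a b × ¬ E G a b)

step : ∀ {n} → SimpleGraph n → Rel (Fin n) 0ℓ × Rel (Fin n) 0ℓ → Rel (Fin n) 0ℓ × Rel (Fin n) 0ℓ
step G (R₁ , R₂) = TransClosure (closeE G R₁ R₂) , TransClosure (closeE G R₂ R₁)

init : ∀ {n} → Fin n → Rel (Fin n) 0ℓ × Rel (Fin n) 0ℓ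
init w = (λ u v → u ≡ w × ¬ v ≡ w) , (λ _ _ → Data.Empty.Polymorphic.⊥)
  where import Data.Empty.Polymorphic

◁seq : ∀ {n} → SimpleGraph n → Fin n → ℕ → Rel (Fin n) 0ℓ × Rel (Fin n) 0ℓ
◁seq G w zero    = init w
◁seq G w (suc k) = step G (◁seq G w k)

◁₁ ◁₂ : ∀ {n} → SimpleGraph n → Fin n → ℕ → Rel (Fin n) 0ℓ
◁₁ G w k = proj₁ (◁seq G w k)
◁₂ G w k = proj₂ (◁seq G w k)

_≐_ : ∀ {n} → Rel (Fin n) 0ℓ → Rel (Fin n) 0ℓ → Set
R ≐ S = ∀ u v → (R u v ⇔ S u v)

StableAt : ∀ {n} → SimpleGraph n → Fin n → ℕ → Set
StableAt G w m = ∀ k → k ≥ m → (◁₁ G w k ≐ ◁₁ G w m) × (◁₂ G w k ≐ ◁₂ G w m)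

module Submission where

-- Both orders of a realizer are closed under E and transitive, so every
-- relation of the sequence lies inside the realizer; it remains to see that the
-- limit relates every pair of distinct vertices. The limit is itself closed under
-- E and transitive, and a vertex comparable with two incomparable vertices x, x′
-- is adjacent to both or to neither. Hence the set of vertices connected to x by
-- chains of incomparable pairs is a module; it contains x and x′ but not w
-- (which precedes everything), contradicting primality.

open import Defs
open import Level using (0ℓ)
open import Data.Bool using (Bool; true; false; not; T)
open import Data.Bool.Properties using (T-≡)
open import Data.Empty using (⊥; ⊥-elim)
open import Data.Fin using (Fin; _≟_)
open import Data.Fin.Properties using (any?)
open import Data.Fin.Subset using (Subset; _∈_)
open import Data.Fin.Subset.Properties using (∈⊤; x∈⁅y⁆⇒x≡y)
open import Data.List using (List; []; _∷_; allFin; cartesianProduct)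
open import Data.List.Membership.Propositional using () renaming (_∈_ to _∈ₗ_)
open import Data.List.Membership.Propositional.Properties using (∈-allFin; ∈-cartesianProduct⁺)
open import Data.List.Relation.Unary.All using (All; []; _∷_; lookup)
open import Data.List.Relation.Unary.Any using (here; there)
open import Data.Nat using (ℕ; zero; suc; _≤_; z≤n; _≤′_; ≤′-refl; ≤′-step)
open import Data.Nat.Properties using (≤⇒≤′; ≤-refl; ≤-trans; <⇒≤)
open import Data.Product using (_×_; _,_; ∃; proj₁; proj₂)
open import Data.Sum using (_⊎_; inj₁; inj₂; swap)
open import Data.Vec using (tabulate)
import Data.Vec.Properties as Vec
open import Function using (_∘_)
open import Function.Bundles using (_⇔_; mk⇔; Equivalence)
open import Function.Construct.Composition using (_⇔-∘_)
open import Function.Construct.Symmetry using (⇔-sym)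
open import Relation.Nullary using (¬_; Dec; yes; no)
open import Relation.Nullary.Decidable
  using (isYes; toWitness; fromWitness; _×-dec_; _⊎-dec_; ¬?; T?; map′)
open import Relation.Binary.Core using (Rel; _⇒_)
open import Relation.Binary.Definitions using (tri<; tri≈; tri>)
open import Relation.Binary.Structures using (IsStrictTotalOrder)
open import Relation.Binary.PropositionalEquality
  using (_≡_; _≢_; refl; subst) renaming (sym to ≡-sym; trans to ≡-trans)
open import Relation.Binary.Construct.Closure.Transitive using (TransClosure; [_]; _∷_)

module Stabilisation {I : Set} (f : ℕ → I → Bool)
                     (f-mono : ∀ k {i} → T (f k i) → T (f (suc k) i)) where

  f-mono-≤ : ∀ {j k i} → j ≤ k → T (f j i) → T (f k i)
  f-mono-≤ {j} j≤k = go (≤⇒≤′ j≤k)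
    where
    go : ∀ {k i} → j ≤′ k → T (f j i) → T (f k i)
    go ≤′-refl         t = t
    go (≤′-step j≤′k) t = f-mono _ (go j≤′k t)

  private
    stable-after : ∀ (is : List I) s →
                   ∃ λ k → s ≤ k × All (λ i → T (f (suc k) i) → T (f k i)) is
    stable-after []       s = s , ≤-refl , []
    stable-after (i ∷ is) s with stable-after is s
    ... | k , s≤k , stable with T? (f (suc k) i)
    ...   | no ¬t = k , s≤k , (⊥-elim ∘ ¬t) ∷ stable
    ...   | yes t with stable-after is (suc k)
    ...     | k′ , k<k′ , stable′ =
              k′ , ≤-trans s≤k (<⇒≤ k<k′) , (λ _ → f-mono-≤ k<k′ t) ∷ stable′

  stabilises : (is : List I) → (∀ i → i ∈ₗ is) →
               ∃ λ k → ∀ i → T (f (suc k) i) → T (f k i)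
  stabilises is complete with stable-after is 0
  ... | k , _ , stable = k , λ i → lookup stable (complete i)

-- L true plays ◁₁ and L false plays ◁₂; the fields say that L is a fixed point of one step.
record IsEClosed {n} (G : SimpleGraph n) (L : Bool → Rel (Fin n) 0ℓ) : Set where
  field
    trans        : ∀ i {a b c} → L i a b → L i b c → L i a c
    edge-swap    : ∀ i {a b} → L (not i) b a → E G a b → L i a b
    nonedge-copy : ∀ i {a b} → L (not i) a b → ¬ E G a b → L i a b

module _ {n} (G : SimpleGraph n) (w : Fin n) where

  ◁ : ℕ → Bool → Rel (Fin n) 0ℓ
  ◁ k true  = ◁₁ G w k
  ◁ k false = ◁₂ G w k

  module _ {L : Bool → Rel (Fin n) 0ℓ} (closed : IsEClosed G L) where
    open IsEClosed closed

    closeE⊆ : ∀ i {S₁ S₂} → S₁ ⇒ L i → S₂ ⇒ L (not i) → closeE G S₁ S₂ ⇒ L i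
    closeE⊆ i S₁⊆ S₂⊆ (inj₁ r)                = S₁⊆ r
    closeE⊆ i S₁⊆ S₂⊆ (inj₂ (inj₁ (s , e)))  = edge-swap i (S₂⊆ s) e
    closeE⊆ i S₁⊆ S₂⊆ (inj₂ (inj₂ (s , ¬e))) = nonedge-copy i (S₂⊆ s) ¬e

    TransClosure-closeE⊆ : ∀ i {S₁ S₂} → S₁ ⇒ L i → S₂ ⇒ L (not i) →
                           TransClosure (closeE G S₁ S₂) ⇒ L i
    TransClosure-closeE⊆ i S₁⊆ S₂⊆ [ r ]    = closeE⊆ i S₁⊆ S₂⊆ r
    TransClosure-closeE⊆ i S₁⊆ S₂⊆ (r ∷ rs) =
      trans i (closeE⊆ i S₁⊆ S₂⊆ r) (TransClosure-closeE⊆ i S₁⊆ S₂⊆ rs)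

    ◁⊆closed : (∀ v → v ≢ w → L true w v) → ∀ k i → ◁ k i ⇒ L i
    ◁⊆closed w-least zero    true  (refl , v≢w) = w-least _ v≢w
    ◁⊆closed w-least zero    false ()
    ◁⊆closed w-least (suc k) true  =
      TransClosure-closeE⊆ true (◁⊆closed w-least k true) (◁⊆closed w-least k false)
    ◁⊆closed w-least (suc k) false =
      TransClosure-closeE⊆ false (◁⊆closed w-least k false) (◁⊆closed w-least k true)

module Totality {n} (G : SimpleGraph n) (E? : ∀ a b → Dec (E G a b))
                {L : Bool → Rel (Fin n) 0ℓ} (L₁? : ∀ a b → Dec (L true a b))
                (closed : IsEClosed G L)
                (w : Fin n) (w-least : ∀ v → v ≢ w → L true w v)
                (prime : Prime G) where
  open IsEClosed closed

  Comparable : Rel (Fin n) 0ℓ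
  Comparable a b = L true a b ⊎ L true b a

  comparable? : ∀ a b → Dec (Comparable a b)
  comparable? a b = L₁? a b ⊎-dec L₁? b a

  L₂⇒comparable : ∀ {a b} → L false a b → Comparable a b
  L₂⇒comparable {a} {b} ab with E? a b
  ... | yes e  = inj₂ (edge-swap true ab (sym G e))
  ... | no ¬e = inj₁ (nonedge-copy true ab ¬e)

  comparable-indistinguishable : ∀ {u x x′} → Comparable u x → Comparable u x′ →
                                 ¬ Comparable x x′ → E G u x → E G u x′
  comparable-indistinguishable {u} {x} {x′} ux ux′ x≁x′ e with E? u x′
  ... | yes e′ = e′
  comparable-indistinguishable (inj₁ u<x) (inj₁ u<x′) x≁x′ e | no ¬e′ =
    ⊥-elim (x≁x′ (L₂⇒comparable
      (trans false (edge-swap false u<x (sym G e)) (nonedge-copy false u<x′ ¬e′))))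
  comparable-indistinguishable (inj₁ u<x) (inj₂ x′<u) x≁x′ e | no ¬e′ =
    ⊥-elim (x≁x′ (inj₂ (trans true x′<u u<x)))
  comparable-indistinguishable (inj₂ x<u) (inj₁ u<x′) x≁x′ e | no ¬e′ =
    ⊥-elim (x≁x′ (inj₁ (trans true x<u u<x′)))
  comparable-indistinguishable (inj₂ x<u) (inj₂ x′<u) x≁x′ e | no ¬e′ =
    ⊥-elim (x≁x′ (swap (L₂⇒comparable
      (trans false (nonedge-copy false x′<u (¬e′ ∘ sym G)) (edge-swap false x<u e)))))

  Incomparable : Rel (Fin n) 0ℓ
  Incomparable a b = a ≢ b × ¬ Comparable a b

  incomparable? : ∀ a b → Dec (Incomparable a b)
  incomparable? a b = ¬? (a ≟ b) ×-dec ¬? (comparable? a b)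

  module IncomparabilityComponent (x x′ : Fin n) (x≁x′ : Incomparable x x′) where
    open Equivalence using (to; from)

    grow : (Fin n → Bool) → Fin n → Bool
    grow S b = isYes (T? (S b) ⊎-dec any? (λ a → T? (S a) ×-dec incomparable? a b))

    reach : ℕ → Fin n → Bool
    reach zero    b = isYes (b ≟ x)
    reach (suc k) = grow (reach k)

    open Stabilisation reach (λ _ t → fromWitness (inj₁ t))

    K : ℕ
    K = proj₁ (stabilises (allFin n) ∈-allFin)

    closed-under-incomparable : ∀ {a b} → T (reach K a) → Incomparable a b → T (reach K b)
    closed-under-incomparable a∈ a≁b =
      proj₂ (stabilises (allFin n) ∈-allFin) _ (fromWitness (inj₂ (_ , a∈ , a≁b)))

    x-reached : T (reach K x)
    x-reached = f-mono-≤ {k = K} {i = x} z≤n (fromWitness refl)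

    w-unreached : ∀ k → ¬ T (reach k w)
    w-unreached zero    w∈ with toWitness w∈
    ... | refl = proj₂ x≁x′ (inj₁ (w-least x′ (proj₁ x≁x′ ∘ ≡-sym)))
    w-unreached (suc k) w∈ with toWitness w∈
    ... | inj₁ w∈′                = w-unreached k w∈′
    ... | inj₂ (a , _ , a≢w , a≁w) = a≁w (inj₂ (w-least a a≢w))

    module _ {u} (u∉ : ¬ T (reach K u)) where

      comparable-to-reached : ∀ {b} → T (reach K b) → Comparable u b
      comparable-to-reached {b} b∈ with comparable? u b
      ... | yes u~b = u~b
      ... | no u≁b =
        ⊥-elim (u∉ (closed-under-incomparable b∈ ((λ { refl → u∉ b∈ }) , u≁b ∘ swap)))

      reached-agree-with-x : ∀ k → k ≤ K → ∀ {b} → T (reach k b) → E G u b ⇔ E G u x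
      reached-agree-with-x zero    _    b∈ with toWitness b∈
      ... | refl = mk⇔ (λ e → e) (λ e → e)
      reached-agree-with-x (suc k) k<K b∈ with toWitness b∈
      ... | inj₁ b∈′ = reached-agree-with-x k (<⇒≤ k<K) b∈′
      ... | inj₂ (a , a∈ , _ , a≁b) =
        reached-agree-with-x k (<⇒≤ k<K) a∈ ⇔-∘ mk⇔
          (comparable-indistinguishable u~b u~a (a≁b ∘ swap))
          (comparable-indistinguishable u~a u~b a≁b)
        where
        u~a = comparable-to-reached (f-mono-≤ (<⇒≤ k<K) a∈)
        u~b = comparable-to-reached (f-mono-≤ k<K b∈)

    M : Subset n
    M = tabulate (reach K)

    ∈M⇔reached : ∀ b → b ∈ M ⇔ T (reach K b)
    ∈M⇔reached b = ⇔-sym T-≡ ⇔-∘ mk⇔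
      (λ b∈M → ≡-trans (≡-sym (Vec.lookup∘tabulate (reach K) b)) (Vec.[]=⇒lookup b∈M))
      (Vec.lookup⇒[]= b M ∘ ≡-trans (Vec.lookup∘tabulate (reach K) b))

    M-isModule : IsModule G M
    M-isModule = (x , from (∈M⇔reached x) x-reached) , λ u y y′ u∉M y∈M y′∈M →
      let agree = reached-agree-with-x (u∉M ∘ from (∈M⇔reached u)) K ≤-refl
      in ⇔-sym (agree (to (∈M⇔reached y′) y′∈M)) ⇔-∘ agree (to (∈M⇔reached y) y∈M)

    absurd : ⊥
    absurd with prime M M-isModule
    ... | inj₁ M≡⊤ = w-unreached K (to (∈M⇔reached w) (subst (w ∈_) (≡-sym M≡⊤) ∈⊤))
    ... | inj₂ (y , M≡⁅y⁆) = proj₁ x≁x′ (≡-trans (in-⁅y⁆ x-reached) (≡-sym (in-⁅y⁆ x′-reached)))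
      where
      in-⁅y⁆ : ∀ {b} → T (reach K b) → b ≡ y
      in-⁅y⁆ b∈ = x∈⁅y⁆⇒x≡y y (subst (_ ∈_) M≡⁅y⁆ (from (∈M⇔reached _) b∈))
      x′-reached = closed-under-incomparable x-reached x≁x′

  total : ∀ a b → a ≢ b → Comparable a b
  total a b a≢b with comparable? a b
  ... | yes a~b = a~b
  ... | no a≁b = ⊥-elim (IncomparabilityComponent.absurd a b (a≢b , a≁b))

module RealizerProperties {n} {G : SimpleGraph n} (R : Realizer G) where

  ord : Bool → Rel (Fin n) 0ℓ
  ord true  = _<₁_ R
  ord false = _<₂_ R

  ord-isStrictTotalOrder : ∀ i → IsStrictTotalOrder _≡_ (ord i)
  ord-isStrictTotalOrder true  = lin₁ R
  ord-isStrictTotalOrder false = lin₂ R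

  private
    module O i = IsStrictTotalOrder (ord-isStrictTotalOrder i)

  ord⇒≢ : ∀ i {a b} → ord i a b → a ≢ b
  ord⇒≢ i a<b refl = O.irrefl i refl a<b

  E? : ∀ a b → Dec (E G a b)
  E? a b with a ≟ b
  ... | yes refl = no (irrefl G)
  ... | no a≢b  = map′ (from (adj R a b a≢b)) (to (adj R a b a≢b))
    ((O._<?_ true a b ×-dec O._<?_ false b a) ⊎-dec (O._<?_ true b a ×-dec O._<?_ false a b))
    where open Equivalence

  ord-isEClosed : IsEClosed G ord
  ord-isEClosed = record
    { trans        = O.trans
    ; edge-swap    = edge-swap
    ; nonedge-copy = nonedge-copy
    }
    where
    open Equivalence

    edge-swap : ∀ i {a b} → ord (not i) b a → E G a b → ord i a b
    edge-swap true  {a} {b} b<₂a e with to (adj R a b (ord⇒≢ false b<₂a ∘ ≡-sym)) e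
    ... | inj₁ (a<₁b , _) = a<₁b
    ... | inj₂ (_ , a<₂b) = ⊥-elim (O.asym false b<₂a a<₂b)
    edge-swap false {a} {b} b<₁a e with to (adj R a b (ord⇒≢ true b<₁a ∘ ≡-sym)) e
    ... | inj₁ (a<₁b , _) = ⊥-elim (O.asym true b<₁a a<₁b)
    ... | inj₂ (_ , a<₂b) = a<₂b

    nonedge-copy : ∀ i {a b} → ord (not i) a b → ¬ E G a b → ord i a b
    nonedge-copy i {a} {b} a<b ¬e with O.compare i a b
    ... | tri< a<ᵢb _ _ = a<ᵢb
    ... | tri≈ _ a≡b _ = ⊥-elim (ord⇒≢ (not i) a<b a≡b)
    nonedge-copy true  a<₂b ¬e | tri> _ _ b<₁a =
      ⊥-elim (¬e (from (adj R _ _ (ord⇒≢ false a<₂b)) (inj₂ (b<₁a , a<₂b))))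
    nonedge-copy false a<₁b ¬e | tri> _ _ b<₂a =
      ⊥-elim (¬e (from (adj R _ _ (ord⇒≢ true a<₁b)) (inj₁ (a<₁b , b<₂a))))

  module _ {L} (closed : IsEClosed G L) where
    open IsEClosed closed

    ord⊆-if-total : (∀ i → L i ⇒ ord i) → (∀ a b → a ≢ b → L true a b ⊎ L true b a) →
                    ∀ i → ord i ⇒ L i
    ord⊆-if-total L⊆ total true a<b with total _ _ (ord⇒≢ true a<b)
    ... | inj₁ Lab = Lab
    ... | inj₂ Lba = ⊥-elim (O.asym true a<b (L⊆ true Lba))
    ord⊆-if-total L⊆ total false {a} {b} a<b with E? a b | total _ _ (ord⇒≢ false a<b)
    ... | yes e  | inj₁ Lab = ⊥-elim (O.asym false a<b (L⊆ false (edge-swap false Lab (sym G e))))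
    ... | yes e  | inj₂ Lba = edge-swap false Lba e
    ... | no ¬e | inj₁ Lab = nonedge-copy false Lab ¬e
    ... | no ¬e | inj₂ Lba =
      ⊥-elim (O.asym false a<b (L⊆ false (nonedge-copy false Lba (¬e ∘ sym G))))

-- The relations ◁ k i are not known to be decidable, so the sequence is shadowed
-- by Bool-valued relations D k (composing only once per step instead of taking the
-- transitive closure); D k ⊆ ◁ k, and D stabilises because it is monotone and finite.
module DecidableShadow {n} (G : SimpleGraph n) (E? : ∀ a b → Dec (E G a b)) (w : Fin n) where

  Step : (Bool → Fin n → Fin n → Bool) → Bool → Rel (Fin n) 0ℓ
  Step D i a b = T (D i a b)
               ⊎ (T (D (not i) b a) × E G a b)
               ⊎ (T (D (not i) a b) × ¬ E G a b)
               ⊎ ∃ λ c → T (D i a c) × T (D i c b)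

  step? : ∀ D i a b → Dec (Step D i a b)
  step? D i a b = T? (D i a b) ⊎-dec (T? (D (not i) b a) ×-dec E? a b)
                  ⊎-dec (T? (D (not i) a b) ×-dec ¬? (E? a b))
                  ⊎-dec any? (λ c → T? (D i a c) ×-dec T? (D i c b))

  D : ℕ → Bool → Fin n → Fin n → Bool
  D zero    true  a b = isYes ((a ≟ w) ×-dec ¬? (b ≟ w))
  D zero    false _ _ = false
  D (suc k) i     a b = isYes (step? (D k) i a b)

  Step⊆TransClosure : ∀ D′ i {S₁ S₂} →
                      (λ a b → T (D′ i a b)) ⇒ S₁ → (λ a b → T (D′ (not i) a b)) ⇒ S₂ →
                      Step D′ i ⇒ TransClosure (closeE G S₁ S₂)
  Step⊆TransClosure _ _ ⊆S₁ _ (inj₁ t) = [ inj₁ (⊆S₁ t) ]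
  Step⊆TransClosure _ _ _ ⊆S₂ (inj₂ (inj₁ (t , e))) = [ inj₂ (inj₁ (⊆S₂ t , e)) ]
  Step⊆TransClosure _ _ _ ⊆S₂ (inj₂ (inj₂ (inj₁ (t , ¬e)))) = [ inj₂ (inj₂ (⊆S₂ t , ¬e)) ]
  Step⊆TransClosure _ _ ⊆S₁ _ (inj₂ (inj₂ (inj₂ (_ , t₁ , t₂)))) =
    inj₁ (⊆S₁ t₁) ∷ [ inj₁ (⊆S₁ t₂) ]

  D⊆◁ : ∀ k i → (λ a b → T (D k i a b)) ⇒ ◁ G w k i
  D⊆◁ zero    true  t = toWitness t
  D⊆◁ zero    false ()
  D⊆◁ (suc k) true  t = Step⊆TransClosure (D k) true  (D⊆◁ k true)  (D⊆◁ k false) (toWitness t)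
  D⊆◁ (suc k) false t = Step⊆TransClosure (D k) false (D⊆◁ k false) (D⊆◁ k true)  (toWitness t)

  Index : Set
  Index = Bool × Fin n × Fin n

  allIndices : List Index
  allIndices = cartesianProduct (true ∷ false ∷ []) (cartesianProduct (allFin n) (allFin n))

  ∈-allIndices : ∀ j → j ∈ₗ allIndices
  ∈-allIndices (i , a , b) =
    ∈-cartesianProduct⁺ (∈-bools i) (∈-cartesianProduct⁺ (∈-allFin a) (∈-allFin b))
    where
    ∈-bools : ∀ i → i ∈ₗ (true ∷ false ∷ [])
    ∈-bools true  = here refl
    ∈-bools false = there (here refl)

  Dᵘ : ℕ → Index → Bool
  Dᵘ k (i , a , b) = D k i a b

  open Stabilisation Dᵘ (λ _ t → fromWitness (inj₁ t)) public

  K : ℕ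
  K = proj₁ (stabilises allIndices ∈-allIndices)

  L : Bool → Rel (Fin n) 0ℓ
  L i a b = T (D K i a b)

  Step⊆L : ∀ i {a b} → Step (D K) i a b → L i a b
  Step⊆L i s = proj₂ (stabilises allIndices ∈-allIndices) (i , _ , _) (fromWitness s)

  L-isEClosed : IsEClosed G L
  L-isEClosed = record
    { trans        = λ i ac cb → Step⊆L i (inj₂ (inj₂ (inj₂ (_ , ac , cb))))
    ; edge-swap    = λ i ba e → Step⊆L i (inj₂ (inj₁ (ba , e)))
    ; nonedge-copy = λ i ab ¬e → Step⊆L i (inj₂ (inj₂ (inj₁ (ab , ¬e))))
    }

  w-least : ∀ v → v ≢ w → L true w v
  w-least v v≢w = f-mono-≤ {k = K} {i = true , w , v} z≤n (fromWitness (refl , v≢w))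

corollary5p7 : ∀ {n} (G : SimpleGraph n) (R : Realizer G) (w : Fin n) →
    Prime G →
    (∀ v → ¬ v ≡ w → _<₁_ R w v) →
    ∃ λ m → StableAt G w m × (◁₁ G w m ≐ _<₁_ R) × (◁₂ G w m ≐ _<₂_ R)
corollary5p7 G R w prime w-first = K , stable , ◁K⇔ord true , ◁K⇔ord false
  where
  open RealizerProperties R
  open DecidableShadow G E? w

  ord⊆L : ∀ i → ord i ⇒ L i
  ord⊆L = ord⊆-if-total L-isEClosed (λ i → ◁⊆closed G w ord-isEClosed w-first K i ∘ D⊆◁ K i)
    (Totality.total G E? (λ a b → T? (D K true a b)) L-isEClosed w w-least prime)

  ◁⇔ord : ∀ k → K ≤ k → ∀ i a b → ◁ G w k i a b ⇔ ord i a b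
  ◁⇔ord k K≤k i a b = mk⇔ (◁⊆closed G w ord-isEClosed w-first k i) (D⊆◁ k i ∘ f-mono-≤ K≤k ∘ ord⊆L i)

  ◁K⇔ord : ∀ i → ◁ G w K i ≐ ord i
  ◁K⇔ord i = ◁⇔ord K ≤-refl i

  stable : StableAt G w K
  stable k K≤k = (λ a b → ⇔-sym (◁K⇔ord true a b) ⇔-∘ ◁⇔ord k K≤k true a b)
               , (λ a b → ⇔-sym (◁K⇔ord false a b) ⇔-∘ ◁⇔ord k K≤k false a b)
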